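{- Let $G$ be a connected finite simple graph with at least $2$ vertices that has a cut vertex. Then a minimum connecting transition set of $G$ has size $|V(G)|-2$.
   Context: A cut vertex is a vertex whose removal disconnects the graph. A transition is a set of two distinct adjacent edges $\{ab,bc\}$ with $a\neq c$, written $abc$. Given a set $T$ of transitions, a walk $(v_1,\dots,v_k)$ is $T$-compatible if for every $i\in[1,k-2]$, either $v_iv_{i+1}v_{i+2}\in T$ or $v_i=v_{i+2}$. $T$ is a connecting transition set of $G$ if for all vertices $u,v$ there is a $T$-compatible walk from $u$ to $v$. -}

module Defs where

open import Data.Nat using (ℕ; zero; suc; _+_; _∸_; _≤_; _<ᵇ_)
open import Data.Nat.ListAction using (sum)
open import Data.Fin using (Fin; toℕ)
open import Data.List using (List; []; _∷_; map; allFin)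
open import Data.Bool using (Bool; true; false; if_then_else_; _∧_)
open import Data.Product using (Σ; _×_; ∃)
open import Data.Sum using (_⊎_)
open import Data.Unit using (⊤)
open import Relation.Nullary using (¬_)
open import Relation.Binary.PropositionalEquality using (_≡_; _≢_)

record SimpleGraph (n : ℕ) : Set where
  field
    adj     : Fin n → Fin n → Bool
    symm    : ∀ x y → adj x y ≡ adj y x
    irrefl  : ∀ x → adj x x ≡ false
open SimpleGraph public

module _ {n : ℕ} (G : SimpleGraph n) where

  IsWalk : List (Fin n) → Set
  IsWalk []            = ⊤
  IsWalk (x ∷ [])      = ⊤
  IsWalk (x ∷ y ∷ r)   = adj G x y ≡ true × IsWalk (y ∷ r)

  AllV : (Fin n → Set) → List (Fin n) → Set
  AllV P []      = ⊤
  AllV P (x ∷ r) = P x × AllV P r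

  lastOf : Fin n → List (Fin n) → Fin n
  lastOf x []      = x
  lastOf x (y ∷ r) = lastOf y r

  -- a walk (u = v₁, …, v_k = v) is given by u and the list (v₂, …, v_k)
  WalkBetween : Fin n → Fin n → Set
  WalkBetween u v = Σ (List (Fin n)) λ ws → IsWalk (u ∷ ws) × lastOf u ws ≡ v

  Connected : Set
  Connected = ∀ u v → WalkBetween u v

  WalkAvoiding : Fin n → Fin n → Fin n → Set
  WalkAvoiding x u v = Σ (List (Fin n)) λ ws →
    IsWalk (u ∷ ws) × lastOf u ws ≡ v × AllV (λ w → w ≢ x) (u ∷ ws)

  IsCutVertex : Fin n → Set
  IsCutVertex x = Σ (Fin n) λ u → Σ (Fin n) λ v →
    u ≢ x × v ≢ x × ¬ WalkAvoiding x u v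

  HasCutVertex : Set
  HasCutVertex = Σ (Fin n) IsCutVertex

  -- A set of transitions is encoded by its characteristic function on
  -- ordered triples (a , b , c); the transition abc = {ab, bc} is the same
  -- as cba, so the function must be symmetric, and it may only contain
  -- genuine transitions (ab, bc edges, a ≠ c).
  record TransitionSet : Set where
    field
      mem       : Fin n → Fin n → Fin n → Bool
      mem-sym   : ∀ a b c → mem a b c ≡ mem c b a
      mem-valid : ∀ a b c → mem a b c ≡ true →
                  adj G a b ≡ true × adj G b c ≡ true × a ≢ c
  open TransitionSet public

  -- number of transitions in T: each transition {ab,bc} is counted once,
  -- via its representative triple with a < c
  size : TransitionSet → ℕ
  size T = sum (map (λ a → sum (map (λ b → sum (map (λ c →
             if (mem T a b c ∧ (toℕ a <ᵇ toℕ c)) then 1 else 0)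
             (allFin n))) (allFin n))) (allFin n))

  Compat : TransitionSet → List (Fin n) → Set
  Compat T (x ∷ y ∷ z ∷ r) = (mem T x y z ≡ true ⊎ x ≡ z) × Compat T (y ∷ z ∷ r)
  Compat T _               = ⊤

  CompatWalkBetween : TransitionSet → Fin n → Fin n → Set
  CompatWalkBetween T u v = Σ (List (Fin n)) λ ws →
    IsWalk (u ∷ ws) × Compat T (u ∷ ws) × lastOf u ws ≡ v

  IsConnectingTransitionSet : TransitionSet → Set
  IsConnectingTransitionSet T = ∀ u v → CompatWalkBetween T u v

  MinConnectingSize : ℕ → Set
  MinConnectingSize m =
    (Σ TransitionSet λ T → IsConnectingTransitionSet T × size T ≡ m)
    × (∀ T → IsConnectingTransitionSet T → m ≤ size T)

module Submission where

-- Lower bound: let x be a cut vertex and T a connecting transition set. Replace each transition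
-- abc of T by the edge ac, or by bc if a = x, or by ab if c = x. Along a T-compatible walk through
-- x, every vertex other than x is joined by these edges to the vertex preceding the first visit
-- of x. So two vertices of G - x are joined by a walk avoiding x or by the new edges, and as
-- G - x is disconnected, all of G - x lies in one component of the new graph. A graph on n
-- vertices with at most two components has at least n - 2 edges, hence |T| ≥ n - 2.
--
-- Upper bound: take a spanning tree rooted at r and a child c₀ of r, and let every vertex
-- v ∉ {r, c₀} contribute the transition (grandparent of v, parent of v, v), where the children
-- of r use c₀ as their grandparent. Every vertex then climbs the tree to r, turns back via
-- r c₀ r, and descends the tree to any other vertex.

open import Defs
open import Level using (0ℓ)
open import Data.Bool using (Bool; true; false; if_then_else_; _∧_; _∨_; not)
open import Data.Bool.ListAction using (any)
open import Data.Bool.Properties using (T-≡; ∨-zeroʳ; ∨-comm; ∧-conicalˡ; ∧-conicalʳ)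
open import Data.Empty using (⊥-elim)
open import Data.Fin as Fin using (Fin; toℕ; _≟_)
open import Data.Fin.Properties using (pigeonhole; <⇒≢; toℕ-injective)
open import Data.List using (List; []; _∷_; _++_; length; lookup; map; concatMap; allFin)
open import Data.List.Membership.Propositional using (_∈_)
open import Data.List.Membership.Propositional.Properties using (∈-concat⁺′; ∈-map⁺; ∈-allFin)
open import Data.List.Properties using (length-++; length-map; map-cong; map-tabulate)
open import Data.List.Relation.Unary.Any using (here; there; index)
open import Data.List.Relation.Unary.Any.Properties using (lookup-index)
open import Data.Nat using (ℕ; zero; suc; pred; _+_; _∸_; _≤_; _<_; _<ᵇ_; _≤?_; z≤n; s≤s)
open import Data.Nat.Induction using (<-wellFounded)
open import Data.Nat.ListAction using (sum)
open import Data.Nat.Properties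
  using (+-suc; +-comm; +-identityʳ; +-mono-≤; +-0-commutativeMonoid; ≤-refl; ≤-antisym;
         <-irrefl; <-trans; <-asym; <-cmp; ≰⇒>; <⇒<ᵇ; <ᵇ⇒<; m≤m+n; m≤n+m; m+n∸n≡m; m≤n+o⇒m∸n≤o;
         module ≤-Reasoning)
open import Algebra.Properties.CommutativeMonoid.Sum +-0-commutativeMonoid
  using (sum-syntax; ∑-distrib-+; ∑-comm; sum-cong-≗; sum-replicate-zero)
  renaming (sum to ∑)
open import Data.Product using (_×_; _,_; ∃; proj₁; proj₂)
import Data.Product as Product
open import Data.Sum using (_⊎_; inj₁; inj₂; [_,_]′)
import Data.Sum as Sum
open import Function using (_∘_; _on_; id; Equivalence)
open import Induction.WellFounded using (Acc; acc)
open import Relation.Binary.Core using (Rel)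
open import Relation.Binary.Definitions using (tri<; tri≈; tri>)
open import Relation.Binary.Construct.Closure.ReflexiveTransitive
  using (Star; ε; _◅_; _◅◅_; reverse)
import Relation.Binary.Construct.Closure.ReflexiveTransitive as Star
open import Relation.Binary.Construct.Closure.Symmetric using (SymClosure; fwd; bwd; symmetric)
open import Relation.Binary.Construct.On using (wellFounded)
open import Relation.Binary.PropositionalEquality
open import Relation.Nullary using (does; yes; no)
open import Relation.Nullary.Decidable using (dec-true; dec-false; toSum)

-- Graphs given by lists of links

Link : ℕ → Set
Link N = Fin N × Fin N

module _ {N : ℕ} where

  Adjacent : List (Link N) → Rel (Fin N) 0ℓ
  Adjacent L = SymClosure (λ u v → (u , v) ∈ L)

  Joined : List (Link N) → Rel (Fin N) 0ℓ
  Joined L = Star (Adjacent L)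

  link-joined : ∀ {L u v} → (u , v) ∈ L → Joined L u v
  link-joined e = fwd e ◅ ε

  joined-sym : ∀ {L u v} → Joined L u v → Joined L v u
  joined-sym = reverse (symmetric _)

  joined-∷ : ∀ {L a b v w} → Joined ((a , b) ∷ L) v w →
             Joined L v w ⊎ Joined L v a ⊎ Joined L v b
  joined-∷ ε                      = inj₁ ε
  joined-∷ (fwd (here refl) ◅ _)  = inj₂ (inj₁ ε)
  joined-∷ (bwd (here refl) ◅ _)  = inj₂ (inj₂ ε)
  joined-∷ (fwd (there e) ◅ p)    = Sum.map (fwd e ◅_) (Sum.map (fwd e ◅_) (fwd e ◅_)) (joined-∷ p)
  joined-∷ (bwd (there e) ◅ p)    = Sum.map (bwd e ◅_) (Sum.map (bwd e ◅_) (bwd e ◅_)) (joined-∷ p)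

  flip-link : ∀ {L a b u v} → Joined ((a , b) ∷ L) u v → Joined ((b , a) ∷ L) u v
  flip-link = Star.map flip
    where
      flip : ∀ {L a b u v} → Adjacent ((a , b) ∷ L) u v → Adjacent ((b , a) ∷ L) u v
      flip (fwd (here refl))  = bwd (here refl)
      flip (bwd (here refl))  = fwd (here refl)
      flip (fwd (there e))    = fwd (there e)
      flip (bwd (there e))    = bwd (there e)

  JoinedToRoot : List (Link N) → List (Fin N) → Fin N → Set
  JoinedToRoot L R v = ∃ λ r → r ∈ R × Joined L v r

  Spans : List (Link N) → List (Fin N) → Set
  Spans L R = ∀ v → JoinedToRoot L R v

  exhaustive⇒≤length : (R : List (Fin N)) → (∀ v → v ∈ R) → N ≤ length R
  exhaustive⇒≤length R ∈R with N ≤? length R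
  ... | yes N≤ = N≤
  ... | no N≰ with pigeonhole (≰⇒> N≰) (λ v → index (∈R v))
  ... | i , j , i<j , same = ⊥-elim (<⇒≢ i<j (begin
          i                   ≡⟨ lookup-index (∈R i) ⟩
          lookup R (index (∈R i)) ≡⟨ cong (lookup R) same ⟩
          lookup R (index (∈R j)) ≡⟨ lookup-index (∈R j) ⟨
          j                   ∎))
    where open ≡-Reasoning

  -- Without the link (a , b) the side of a may be cut off from rb; a becomes its root.
  drop-link : ∀ {L R a b rb} → Spans ((a , b) ∷ L) R → rb ∈ R → Joined L b rb → Spans L (a ∷ R)
  drop-link spans rb∈R b~rb v with spans v
  ... | r , r∈R , v~r with joined-∷ v~r
  ... | inj₁ v~r′        = r , there r∈R , v~r′
  ... | inj₂ (inj₁ v~a)  = _ , here refl , v~a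
  ... | inj₂ (inj₂ v~b)  = _ , there rb∈R , v~b ◅◅ b~rb

  ≤links+roots : (L : List (Link N)) (R : List (Fin N)) → Spans L R → N ≤ length L + length R
  ≤links+roots [] R spans = exhaustive⇒≤length R (λ v → root∈R (spans v))
    where
      root∈R : ∀ {v} → JoinedToRoot [] R v → v ∈ R
      root∈R (_ , r∈R , ε) = r∈R
      root∈R (_ , _ , fwd () ◅ _)
      root∈R (_ , _ , bwd () ◅ _)
  ≤links+roots ((a , b) ∷ L) R spans
    rewrite sym (+-suc (length L) (length R)) with spans b
  ... | rb , rb∈R , b~rb with joined-∷ (joined-sym b~rb)
  ... | inj₁ rb~b        = ≤links+roots L (a ∷ R) (drop-link spans rb∈R (joined-sym rb~b))
  ... | inj₂ (inj₂ rb~b) = ≤links+roots L (a ∷ R) (drop-link spans rb∈R (joined-sym rb~b))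
  ... | inj₂ (inj₁ rb~a) =
    ≤links+roots L (b ∷ R) (drop-link flipped rb∈R (joined-sym rb~a))
    where
      flipped : Spans ((b , a) ∷ L) R
      flipped v = Product.map₂ (Product.map₂ flip-link) (spans v)

adj-sym : ∀ {n} (G : SimpleGraph n) {u v} → adj G u v ≡ true → adj G v u ≡ true
adj-sym G {u} {v} uv = trans (symm G v u) uv

adj⇒≢ : ∀ {n} (G : SimpleGraph n) {u v} → adj G u v ≡ true → u ≢ v
adj⇒≢ G {u} uv refl with trans (sym uv) (irrefl G u)
... | ()

≟⇒≡ : ∀ {n} {a b : Fin n} → does (a ≟ b) ≡ true → a ≡ b
≟⇒≡ {a = a} {b} e with a ≟ b
... | yes a≡b = a≡b

module _ {n : ℕ} {G : SimpleGraph n} where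

  Turn : TransitionSet G → Fin n → Fin n → Fin n → Set
  Turn T a b c = mem T a b c ≡ true ⊎ a ≡ c

  turn-sym : ∀ {T a b c} → Turn T a b c → Turn T c b a
  turn-sym {T} {a} {b} {c} (inj₁ abc) = inj₁ (trans (mem-sym T c b a) abc)
  turn-sym (inj₂ a≡c) = inj₂ (sym a≡c)

  isWalk-++ : ∀ u ws₁ ws₂ → IsWalk G (u ∷ ws₁) → IsWalk G (lastOf G u ws₁ ∷ ws₂) →
              IsWalk G (u ∷ ws₁ ++ ws₂)
  isWalk-++ u []        ws₂ _          walk₂ = walk₂
  isWalk-++ u (w ∷ ws₁) ws₂ (uw , walk₁) walk₂ = uw , isWalk-++ w ws₁ ws₂ walk₁ walk₂

  lastOf-++ : ∀ u ws₁ ws₂ → lastOf G u (ws₁ ++ ws₂) ≡ lastOf G (lastOf G u ws₁) ws₂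
  lastOf-++ u []        ws₂ = refl
  lastOf-++ u (w ∷ ws₁) ws₂ = lastOf-++ w ws₁ ws₂

  allV-++ : ∀ {P} u ws₁ ws₂ → AllV G P (u ∷ ws₁) → AllV G P (lastOf G u ws₁ ∷ ws₂) →
            AllV G P (u ∷ ws₁ ++ ws₂)
  allV-++ u []        ws₂ _            all₂ = all₂
  allV-++ u (w ∷ ws₁) ws₂ (Pu , all₁) all₂ = Pu , allV-++ w ws₁ ws₂ all₁ all₂

  walkAvoiding-trans : ∀ {x u v w} → WalkAvoiding G x u v → WalkAvoiding G x v w → WalkAvoiding G x u w
  walkAvoiding-trans {u = u} (ws₁ , walk₁ , refl , avoid₁) (ws₂ , walk₂ , refl , avoid₂) =
    ws₁ ++ ws₂ , isWalk-++ u ws₁ ws₂ walk₁ walk₂ , lastOf-++ u ws₁ ws₂ , allV-++ u ws₁ ws₂ avoid₁ avoid₂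

length-concatMap : ∀ {A B : Set} (f : A → List B) xs →
                   length (concatMap f xs) ≡ sum (map (length ∘ f) xs)
length-concatMap f []       = refl
length-concatMap f (x ∷ xs) = trans (length-++ (f x)) (cong (length (f x) +_) (length-concatMap f xs))

∈-concatMap : ∀ {A B : Set} {f : A → List B} {x xs y} → y ∈ f x → x ∈ xs → y ∈ concatMap f xs
∈-concatMap {f = f} y∈fx x∈xs = ∈-concat⁺′ y∈fx (∈-map⁺ f x∈xs)

Triple : ℕ → Set
Triple n = Fin n × Fin n × Fin n

_<ᶠ_ : ∀ {n} → Fin n → Fin n → Bool
a <ᶠ c = toℕ a <ᵇ toℕ c

module _ {n : ℕ} {G : SimpleGraph n} where

  counted : TransitionSet G → Fin n → Fin n → Fin n → Bool
  counted T a b c = mem T a b c ∧ (a <ᶠ c)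

  ifSingleton : Bool → Triple n → List (Triple n)
  ifSingleton b t = if b then t ∷ [] else []

  transitionList : TransitionSet G → List (Triple n)
  transitionList T = concatMap (λ a → concatMap (λ b → concatMap (λ c →
    ifSingleton (counted T a b c) (a , b , c)) (allFin n)) (allFin n)) (allFin n)

  length-transitionList : ∀ T → length (transitionList T) ≡ size G T
  length-transitionList T =
    trans (length-concatMap _ (allFin n)) (cong sum (map-cong (λ a →
    trans (length-concatMap _ (allFin n)) (cong sum (map-cong (λ b →
    trans (length-concatMap _ (allFin n)) (cong sum (map-cong (λ c →
    length-ifSingleton (counted T a b c)) (allFin n)))) (allFin n)))) (allFin n)))
    where
      length-ifSingleton : ∀ b {t} → length (ifSingleton b t) ≡ (if b then 1 else 0)
      length-ifSingleton true  = refl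
      length-ifSingleton false = refl

  ∈-transitionList : ∀ T {a b c} → counted T a b c ≡ true → (a , b , c) ∈ transitionList T
  ∈-transitionList T {a} {b} {c} abc =
    ∈-concatMap (∈-concatMap (∈-concatMap abc∈ (∈-allFin c)) (∈-allFin b)) (∈-allFin a)
    where
      abc∈ : (a , b , c) ∈ ifSingleton (counted T a b c) (a , b , c)
      abc∈ = subst (λ β → (a , b , c) ∈ ifSingleton β (a , b , c)) (sym abc) (here refl)

  transition∈transitionList : ∀ T {a b c} → mem T a b c ≡ true →
    (a , b , c) ∈ transitionList T ⊎ (c , b , a) ∈ transitionList T
  transition∈transitionList T {a} {b} {c} abc with <-cmp (toℕ a) (toℕ c)
  ... | tri< a<c _ _ = inj₁ (∈-transitionList T (cong₂ _∧_ abc (Equivalence.to T-≡ (<⇒<ᵇ a<c))))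
  ... | tri≈ _ a≡c _ = ⊥-elim (proj₂ (proj₂ (mem-valid T a b c abc)) (toℕ-injective a≡c))
  ... | tri> _ _ c<a =
    inj₂ (∈-transitionList T (cong₂ _∧_ (trans (mem-sym T c b a) abc) (Equivalence.to T-≡ (<⇒<ᵇ c<a))))

-- The lower bound

module LowerBound {n : ℕ} {G : SimpleGraph n} (T : TransitionSet G) (x : Fin n) where

  shortcut : Triple n → Link n
  shortcut (a , b , c) with a ≟ x | c ≟ x
  ... | yes _ | _     = b , c
  ... | no _  | yes _ = a , b
  ... | no _  | no _  = a , c

  shortcuts : List (Link n)
  shortcuts = map shortcut (transitionList T)

  infix 4 _~_
  _~_ : Fin n → Fin n → Set
  _~_ = Joined shortcuts

  record Bridged (a b c : Fin n) : Set where
    field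
      from-x   : a ≡ x → b ~ c
      to-x     : c ≡ x → b ~ a
      avoiding : a ≢ x → c ≢ x → a ~ c

  bridged-sym : ∀ {a b c} → Bridged a b c → Bridged c b a
  bridged-sym br = record
    { from-x   = Bridged.to-x br
    ; to-x     = Bridged.from-x br
    ; avoiding = λ c≢x a≢x → joined-sym (Bridged.avoiding br a≢x c≢x)
    }

  shortcut-bridged : ∀ {a b c} → a ≢ c → shortcut (a , b , c) ∈ shortcuts → Bridged a b c
  shortcut-bridged {a} {b} {c} a≢c ∈sc with a ≟ x | c ≟ x
  ... | yes a≡x | _ = record
    { from-x   = λ _ → link-joined ∈sc
    ; to-x     = λ c≡x → ⊥-elim (a≢c (trans a≡x (sym c≡x)))
    ; avoiding = λ a≢x _ → ⊥-elim (a≢x a≡x)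
    }
  ... | no a≢x | yes c≡x = record
    { from-x   = λ a≡x → ⊥-elim (a≢x a≡x)
    ; to-x     = λ _ → joined-sym (link-joined ∈sc)
    ; avoiding = λ _ c≢x → ⊥-elim (c≢x c≡x)
    }
  ... | no a≢x | no c≢x = record
    { from-x   = λ a≡x → ⊥-elim (a≢x a≡x)
    ; to-x     = λ c≡x → ⊥-elim (c≢x c≡x)
    ; avoiding = λ _ _ → link-joined ∈sc
    }

  transition-bridged : ∀ {a b c} → mem T a b c ≡ true → Bridged a b c
  transition-bridged {a} {b} {c} abc with transition∈transitionList T abc
  ... | inj₁ abc∈ = shortcut-bridged a≢c (∈-map⁺ shortcut abc∈)
    where a≢c = proj₂ (proj₂ (mem-valid T a b c abc))
  ... | inj₂ cba∈ = bridged-sym (shortcut-bridged (a≢c ∘ sym) (∈-map⁺ shortcut cba∈))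
    where a≢c = proj₂ (proj₂ (mem-valid T a b c abc))

  Near : Fin n → Fin n → Set
  Near c u = u ≡ x ⊎ u ~ c

  near⇒~ : ∀ {c u} → Near c u → u ≢ x → u ~ c
  near⇒~ (inj₁ u≡x) u≢x = ⊥-elim (u≢x u≡x)
  near⇒~ (inj₂ u~c) _   = u~c

  near-step : ∀ {c u v w} → Turn T u v w → Near c u → Near c v → Near c w
  near-step (inj₂ refl) near-u _ = near-u
  near-step {c} {u} {v} {w} (inj₁ uvw) near-u near-v with w ≟ x | u ≟ x
  ... | yes w≡x | _       = inj₁ w≡x
  ... | no w≢x  | yes u≡x = inj₂ (joined-sym (Bridged.from-x br u≡x) ◅◅ near⇒~ near-v v≢x)
    where
      br  = transition-bridged uvw
      v≢x = λ v≡x → adj⇒≢ G (proj₁ (mem-valid T u v w uvw)) (trans u≡x (sym v≡x))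
  ... | no w≢x  | no u≢x  =
    inj₂ (joined-sym (Bridged.avoiding (transition-bridged uvw) u≢x w≢x) ◅◅ near⇒~ near-u u≢x)

  near-lastOf : ∀ {c} u v ws → Compat G T (u ∷ v ∷ ws) → Near c u → Near c v → Near c (lastOf G v ws)
  near-lastOf u v []       _                near-u near-v = near-v
  near-lastOf u v (w ∷ ws) (uvw , compat) near-u near-v =
    near-lastOf v w ws compat near-v (near-step uvw near-u near-v)

  -- the anchor c is the last vertex before the walk first meets x
  avoids-or-near : ∀ u v ws → Compat G T (u ∷ v ∷ ws) → u ≢ x →
                   AllV G (_≢ x) (u ∷ v ∷ ws) ⊎ ∃ λ c → Near c u × Near c v
  avoids-or-near u v ws compat u≢x with v ≟ x
  ... | yes v≡x = inj₂ (u , inj₂ ε , inj₁ v≡x)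
  avoids-or-near u v [] compat u≢x | no v≢x = inj₁ (u≢x , v≢x , _)
  avoids-or-near u v (w ∷ ws) (uvw , compat) u≢x | no v≢x with avoids-or-near v w ws compat v≢x
  ... | inj₁ avoid = inj₁ (u≢x , avoid)
  ... | inj₂ (c , near-v , near-w) =
    inj₂ (c , near-step (turn-sym {T = T} {b = v} uvw) near-w near-v , near-v)

  compatible-avoids-or-joined : ∀ {u v} → u ≢ x → v ≢ x → CompatWalkBetween G T u v →
                                WalkAvoiding G x u v ⊎ u ~ v
  compatible-avoids-or-joined u≢x v≢x ([] , _ , _ , refl) = inj₂ ε
  compatible-avoids-or-joined {u} u≢x v≢x (w ∷ ws , walk , compat , end)
    with avoids-or-near u w ws compat u≢x
  ... | inj₁ avoid = inj₁ (w ∷ ws , walk , end , avoid)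
  ... | inj₂ (c , near-u , near-w) =
    inj₂ (near⇒~ near-u u≢x ◅◅ joined-sym (near⇒~ (subst (Near c) end near-v) v≢x))
    where near-v = near-lastOf u w ws compat near-u near-w

  size-≥ : IsConnectingTransitionSet G T → IsCutVertex G x → n ∸ 2 ≤ size G T
  size-≥ connecting (p , q , p≢x , q≢x , p↮q) = begin
    n ∸ 2                          ≤⟨ m≤n+o⇒m∸n≤o n 2 (subst (n ≤_) (+-comm _ 2) n≤) ⟩
    length shortcuts               ≡⟨ length-map shortcut (transitionList T) ⟩
    length (transitionList T)      ≡⟨ length-transitionList T ⟩
    size G T                       ∎
    where
      open ≤-Reasoning
      route : ∀ {u v} → u ≢ x → v ≢ x → WalkAvoiding G x u v ⊎ u ~ v
      route u≢x v≢x = compatible-avoids-or-joined u≢x v≢x (connecting _ _)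

      ~p : ∀ {y} → y ≢ x → y ~ p
      ~p y≢x with route p≢x y≢x | route y≢x q≢x | route p≢x q≢x
      ... | inj₂ p~y | _        | _        = joined-sym p~y
      ... | inj₁ p⇝y | inj₁ y⇝q | _        = ⊥-elim (p↮q (walkAvoiding-trans p⇝y y⇝q))
      ... | inj₁ _   | inj₂ _   | inj₁ p⇝q = ⊥-elim (p↮q p⇝q)
      ... | inj₁ _   | inj₂ y~q | inj₂ p~q = y~q ◅◅ joined-sym p~q

      spans : Spans shortcuts (x ∷ p ∷ [])
      spans y with y ≟ x
      ... | yes refl = x , here refl , ε
      ... | no y≢x   = p , there (here refl) , ~p y≢x

      n≤ : n ≤ length shortcuts + 2
      n≤ = ≤links+roots shortcuts (x ∷ p ∷ []) spans

-- Counting transitions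

χ : Bool → ℕ
χ b = if b then 1 else 0

sum-allFin : ∀ {n} (f : Fin n → ℕ) → sum (map f (allFin n)) ≡ ∑[ i < n ] f i
sum-allFin {zero}  f = refl
sum-allFin {suc n} f = cong (f Fin.zero +_) (trans
  (cong sum (trans (map-tabulate Fin.suc f) (sym (map-tabulate id (f ∘ Fin.suc)))))
  (sum-allFin (f ∘ Fin.suc)))

∑-mono : ∀ {n} {f g : Fin n → ℕ} → (∀ i → f i ≤ g i) → ∑[ i < n ] f i ≤ ∑[ i < n ] g i
∑-mono {zero}  f≤g = z≤n
∑-mono {suc n} f≤g = +-mono-≤ (f≤g Fin.zero) (∑-mono (f≤g ∘ Fin.suc))

∑-pick : ∀ {n} (k : Fin n) (f : Fin n → Bool) → ∑[ i < n ] χ (does (i ≟ k) ∧ f i) ≡ χ (f k)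
∑-pick {suc n} Fin.zero    f = trans (cong (χ (f Fin.zero) +_) (sum-replicate-zero n)) (+-identityʳ _)
∑-pick {suc n} (Fin.suc k) f = ∑-pick k (f ∘ Fin.suc)

∑-const-1 : ∀ n → ∑[ i < n ] 1 ≡ n
∑-const-1 zero    = refl
∑-const-1 (suc n) = cong suc (∑-const-1 n)

∑-all-but-two : ∀ {n} {r c : Fin n} → r ≢ c →
  ∑[ v < n ] χ (not (does (v ≟ r)) ∧ not (does (v ≟ c))) ≡ n ∸ 2
∑-all-but-two {n} {r} {c} r≢c = begin
  ∑[ v < n ] others v                 ≡⟨ m+n∸n≡m _ 2 ⟨
  ∑[ v < n ] others v + 2 ∸ 2         ≡⟨ cong (_∸ 2) with-r-c ⟩
  n ∸ 2                               ∎
  where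
    open ≡-Reasoning
    others isR isC : Fin n → ℕ
    others v = χ (not (does (v ≟ r)) ∧ not (does (v ≟ c)))
    isR v = χ (does (v ≟ r) ∧ true)
    isC v = χ (does (v ≟ c) ∧ true)

    exactly-one : ∀ v → others v + (isR v + isC v) ≡ 1
    exactly-one v with does (v ≟ r) in v≡r | does (v ≟ c) in v≡c
    ... | false | false = refl
    ... | false | true  = refl
    ... | true  | false = refl
    ... | true  | true  = ⊥-elim (r≢c (trans (sym (≟⇒≡ {a = v} v≡r)) (≟⇒≡ {a = v} v≡c)))

    with-r-c : ∑[ v < n ] others v + 2 ≡ n
    with-r-c = begin
      ∑[ v < n ] others v + 2
        ≡⟨ cong (∑[ v < n ] others v +_) (cong₂ _+_ (∑-pick r (λ _ → true)) (∑-pick c (λ _ → true))) ⟨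
      ∑[ v < n ] others v + (∑[ v < n ] isR v + ∑[ v < n ] isC v)
        ≡⟨ cong (∑[ v < n ] others v +_) (∑-distrib-+ isR isC) ⟨
      ∑[ v < n ] others v + ∑[ v < n ] (isR v + isC v)
        ≡⟨ ∑-distrib-+ others (λ v → isR v + isC v) ⟨
      ∑[ v < n ] (others v + (isR v + isC v))
        ≡⟨ sum-cong-≗ exactly-one ⟩
      ∑[ v < n ] 1
        ≡⟨ ∑-const-1 n ⟩
      n ∎

module _ {n : ℕ} where

  OwnedBy : (Fin n → Bool) → (Fin n → Fin n) → (Fin n → Fin n) → Fin n → Fin n → Fin n → Set
  OwnedBy S g p a b v = S v ≡ true × a ≡ g v × b ≡ p v

module _ {n : ℕ} {G : SimpleGraph n} where

  size-as-∑ : ∀ T → size G T ≡ ∑[ a < n ] ∑[ b < n ] ∑[ c < n ] χ (counted T a b c)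
  size-as-∑ T = trans (sum-allFin rowSum) (sum-cong-≗ λ a →
                trans (sum-allFin (cellSum a)) (sum-cong-≗ λ b → sum-allFin (λ c → χ (counted T a b c))))
    where
      cellSum : Fin n → Fin n → ℕ
      cellSum a b = sum (map (λ c → χ (counted T a b c)) (allFin n))
      rowSum : Fin n → ℕ
      rowSum a = sum (map (cellSum a) (allFin n))

  size-≤-owners : ∀ T (S : Fin n → Bool) (g p : Fin n → Fin n) →
    (∀ {a b c} → mem T a b c ≡ true → OwnedBy S g p a b c ⊎ OwnedBy S g p c b a) →
    size G T ≤ ∑[ v < n ] χ (S v)
  size-≤-owners T S g p owned = begin
    size G T
      ≡⟨ size-as-∑ T ⟩
    ∑[ a < n ] ∑[ b < n ] ∑[ c < n ] χ (counted T a b c)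
      ≤⟨ ∑-mono (λ a → ∑-mono (λ b → ∑-mono (λ c → split a b c))) ⟩
    ∑[ a < n ] ∑[ b < n ] ∑[ c < n ] (byHead a b c + byTail a b c)
      ≡⟨ sum-cong-≗ (λ a → sum-cong-≗ λ b → ∑-distrib-+ (byHead a b) (byTail a b)) ⟩
    ∑[ a < n ] ∑[ b < n ] (∑[ c < n ] byHead a b c + ∑[ c < n ] byTail a b c)
      ≡⟨ sum-cong-≗ (λ a → ∑-distrib-+ (λ b → ∑[ c < n ] byHead a b c) (λ b → ∑[ c < n ] byTail a b c)) ⟩
    ∑[ a < n ] (∑[ b < n ] ∑[ c < n ] byHead a b c + ∑[ b < n ] ∑[ c < n ] byTail a b c)
      ≡⟨ ∑-distrib-+ (λ a → ∑[ b < n ] ∑[ c < n ] byHead a b c) (λ a → ∑[ b < n ] ∑[ c < n ] byTail a b c) ⟩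
    ∑[ a < n ] ∑[ b < n ] ∑[ c < n ] byHead a b c + ∑[ a < n ] ∑[ b < n ] ∑[ c < n ] byTail a b c
      ≡⟨ cong₂ _+_ sum-byHead sum-byTail ⟩
    ∑[ v < n ] χ (S v ∧ (g v <ᶠ v)) + ∑[ v < n ] χ (S v ∧ (v <ᶠ g v))
      ≡⟨ ∑-distrib-+ (λ v → χ (S v ∧ (g v <ᶠ v))) (λ v → χ (S v ∧ (v <ᶠ g v))) ⟨
    ∑[ v < n ] (χ (S v ∧ (g v <ᶠ v)) + χ (S v ∧ (v <ᶠ g v)))
      ≤⟨ ∑-mono one-orientation ⟩
    ∑[ v < n ] χ (S v) ∎
    where
      open ≤-Reasoning

      byHead byTail : Fin n → Fin n → Fin n → ℕ
      byHead a b c = χ (does (b ≟ p c) ∧ (does (a ≟ g c) ∧ (S c ∧ (a <ᶠ c))))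
      byTail a b c = χ (does (c ≟ g a) ∧ (does (b ≟ p a) ∧ (S a ∧ (a <ᶠ c))))

      split : ∀ a b c → χ (counted T a b c) ≤ byHead a b c + byTail a b c
      split a b c with mem T a b c in abc
      ... | false = z≤n
      ... | true with owned abc
      ... | inj₁ (Sc , refl , refl)
        rewrite dec-true (p c ≟ p c) refl | dec-true (g c ≟ g c) refl | Sc = m≤m+n _ _
      ... | inj₂ (Sa , refl , refl)
        rewrite dec-true (g a ≟ g a) refl | dec-true (p a ≟ p a) refl | Sa = m≤n+m _ _

      sum-byHead : ∑[ a < n ] ∑[ b < n ] ∑[ c < n ] byHead a b c ≡ ∑[ c < n ] χ (S c ∧ (g c <ᶠ c))
      sum-byHead = begin-equality
        ∑[ a < n ] ∑[ b < n ] ∑[ c < n ] byHead a b c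
          ≡⟨ sum-cong-≗ (λ a → ∑-comm (byHead a)) ⟩
        ∑[ a < n ] ∑[ c < n ] ∑[ b < n ] byHead a b c
          ≡⟨ ∑-comm (λ a c → ∑[ b < n ] byHead a b c) ⟩
        ∑[ c < n ] ∑[ a < n ] ∑[ b < n ] byHead a b c
          ≡⟨ sum-cong-≗ (λ c → sum-cong-≗ λ a → ∑-pick (p c) (λ _ → does (a ≟ g c) ∧ (S c ∧ (a <ᶠ c)))) ⟩
        ∑[ c < n ] ∑[ a < n ] χ (does (a ≟ g c) ∧ (S c ∧ (a <ᶠ c)))
          ≡⟨ sum-cong-≗ (λ c → ∑-pick (g c) (λ a → S c ∧ (a <ᶠ c))) ⟩
        ∑[ c < n ] χ (S c ∧ (g c <ᶠ c)) ∎

      sum-byTail : ∑[ a < n ] ∑[ b < n ] ∑[ c < n ] byTail a b c ≡ ∑[ a < n ] χ (S a ∧ (a <ᶠ g a))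
      sum-byTail = begin-equality
        ∑[ a < n ] ∑[ b < n ] ∑[ c < n ] byTail a b c
          ≡⟨ sum-cong-≗ (λ a → sum-cong-≗ λ b → ∑-pick (g a) (λ c → does (b ≟ p a) ∧ (S a ∧ (a <ᶠ c)))) ⟩
        ∑[ a < n ] ∑[ b < n ] χ (does (b ≟ p a) ∧ (S a ∧ (a <ᶠ g a)))
          ≡⟨ sum-cong-≗ (λ a → ∑-pick (p a) (λ _ → S a ∧ (a <ᶠ g a))) ⟩
        ∑[ a < n ] χ (S a ∧ (a <ᶠ g a)) ∎

      one-orientation : ∀ v → χ (S v ∧ (g v <ᶠ v)) + χ (S v ∧ (v <ᶠ g v)) ≤ χ (S v)
      one-orientation v with S v
      ... | false = z≤n
      ... | true with g v <ᶠ v in gv<v | v <ᶠ g v in v<gv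
      ... | false | false = z≤n
      ... | false | true  = ≤-refl
      ... | true  | false = ≤-refl
      ... | true  | true  = ⊥-elim (<-asym (<ᵇ⇒< (toℕ (g v)) (toℕ v) (Equivalence.from T-≡ gv<v))
                                          (<ᵇ⇒< (toℕ v) (toℕ (g v)) (Equivalence.from T-≡ v<gv)))

-- Rooted spanning trees

record RootedTree {n : ℕ} (G : SimpleGraph n) (r : Fin n) : Set where
  field
    parent       : Fin n → Fin n
    depth        : Fin n → ℕ
    parent-adj   : ∀ {v} → v ≢ r → adj G v (parent v) ≡ true
    depth-parent : ∀ {v} → v ≢ r → depth (parent v) < depth v

  data Climb : Fin n → Fin n → Set where
    stay : ∀ {v} → Climb v v
    up   : ∀ {v y} → parent v ≢ r → Climb (parent v) y → Climb v y

  climb : ∀ {v} → v ≢ r → ∃ λ y → Climb v y × parent y ≡ r × y ≢ r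
  climb {v} = go v (wellFounded depth <-wellFounded v)
    where
      go : ∀ v → Acc (_<_ on depth) v → v ≢ r → ∃ λ y → Climb v y × parent y ≡ r × y ≢ r
      go v (acc below) v≢r with parent v ≟ r
      ... | yes pv≡r = v , stay , pv≡r , v≢r
      ... | no pv≢r with go (parent v) (below (depth-parent v≢r)) pv≢r
      ...   | y , pv⇝y , py≡r , y≢r = y , up pv≢r pv⇝y , py≡r , y≢r

least : (ℕ → Bool) → ℕ → ℕ
least f zero    = zero
least f (suc B) = if f 0 then 0 else suc (least (f ∘ suc) B)

least-holds : ∀ (f : ℕ → Bool) B → f B ≡ true → f (least f B) ≡ true
least-holds f zero    fB = fB
least-holds f (suc B) fB with f 0 in f0
... | true  = f0
... | false = least-holds (f ∘ suc) B fB

least-≤ : ∀ (f : ℕ → Bool) B k → f k ≡ true → least f B ≤ k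
least-≤ f zero    k       fk = z≤n
least-≤ f (suc B) k       fk with f 0 in f0
... | true = z≤n
least-≤ f (suc B) zero    fk | false with () ← trans (sym f0) fk
least-≤ f (suc B) (suc k) fk | false = s≤s (least-≤ (f ∘ suc) B k fk)

module _ {A : Set} where

  find-or : (A → Bool) → A → List A → A
  find-or f d []       = d
  find-or f d (x ∷ xs) = if f x then x else find-or f d xs

  find-or-holds : ∀ (f : A → Bool) d xs → any f xs ≡ true → f (find-or f d xs) ≡ true
  find-or-holds f d (x ∷ xs) fxs with f x in fx
  ... | true  = fx
  ... | false = find-or-holds f d xs fxs

  any-holds : ∀ {f : A → Bool} {x xs} → f x ≡ true → x ∈ xs → any f xs ≡ true
  any-holds fx (here refl) rewrite fx = refl
  any-holds {f} {xs = y ∷ ys} fx (there x∈ys) rewrite any-holds {f} fx x∈ys = ∨-zeroʳ (f y)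

module BreadthFirst {n : ℕ} (G : SimpleGraph n) (connected : Connected G) (r : Fin n) where

  within : ℕ → Fin n → Bool
  within zero    v = does (v ≟ r)
  within (suc k) v = within k v ∨ any (λ w → adj G v w ∧ within k w) (allFin n)

  walk⇒within : ∀ v ws → IsWalk G (v ∷ ws) → lastOf G v ws ≡ r → within (length ws) v ≡ true
  walk⇒within v []       _           refl = dec-true (v ≟ v) refl
  walk⇒within v (w ∷ ws) (vw , walk) end
    = trans (cong (within (length ws) v ∨_) (any-holds {f = λ u → adj G v u ∧ within (length ws) u}
                      (cong₂ _∧_ vw (walk⇒within w ws walk end)) (∈-allFin w)))
            (∨-zeroʳ (within (length ws) v))

  walkLength : Fin n → ℕ
  walkLength v = length (proj₁ (connected v r))

  depth : Fin n → ℕ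
  depth v = least (λ k → within k v) (walkLength v)

  within-depth : ∀ v → within (depth v) v ≡ true
  within-depth v = least-holds (λ k → within k v) (walkLength v)
    (walk⇒within v _ (proj₁ (proj₂ (connected v r))) (proj₂ (proj₂ (connected v r))))

  depth-≤ : ∀ v k → within k v ≡ true → depth v ≤ k
  depth-≤ v = least-≤ (λ k → within k v) (walkLength v)

  towards : ℕ → Fin n → Fin n
  towards k v = find-or (λ w → adj G v w ∧ within k w) r (allFin n)

  parent : Fin n → Fin n
  parent v = towards (pred (depth v)) v

  parent-spec : ∀ {v} → v ≢ r → adj G v (parent v) ≡ true × depth (parent v) < depth v
  parent-spec {v} v≢r with depth v in depth≡ | within-depth v
  ... | zero  | at-r = ⊥-elim (v≢r (≟⇒≡ at-r))
  ... | suc k | within-sk with within k v in within-k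
  ...   | true  = ⊥-elim (<-irrefl refl (subst (_≤ k) depth≡ (depth-≤ v k within-k)))
  ...   | false = ∧-conicalˡ _ _ spec , s≤s (depth-≤ _ k (∧-conicalʳ _ _ spec))
    where spec = find-or-holds (λ w → adj G v w ∧ within k w) r (allFin n) within-sk

bfsTree : ∀ {n} {G : SimpleGraph n} → Connected G → (r : Fin n) → RootedTree G r
bfsTree {G = G} connected r = record
  { parent       = parent
  ; depth        = depth
  ; parent-adj   = proj₁ ∘ parent-spec
  ; depth-parent = proj₂ ∘ parent-spec
  }
  where open BreadthFirst G connected r

-- The upper bound

module ArcWalks {n : ℕ} {G : SimpleGraph n} (T : TransitionSet G) where

  -- ArcWalk a b y z: a T-compatible walk whose first arc is ab and whose last arc is yz
  data ArcWalk : Fin n → Fin n → Fin n → Fin n → Set where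
    arc  : ∀ {a b} → adj G a b ≡ true → ArcWalk a b a b
    step : ∀ {a b c y z} → adj G a b ≡ true → Turn T a b c → ArcWalk b c y z → ArcWalk a b y z

  vertices : ∀ {a b y z} → ArcWalk a b y z → List (Fin n)
  vertices (arc {b = b} _)      = b ∷ []
  vertices (step {b = b} _ _ w) = b ∷ vertices w

  arcWalk⇒compatible : ∀ {a b y z} → ArcWalk a b y z → CompatWalkBetween G T a z
  arcWalk⇒compatible w = vertices w , isWalk w , compat w , last w
    where
      isWalk : ∀ {a b y z} (w : ArcWalk a b y z) → IsWalk G (a ∷ vertices w)
      isWalk (arc ab)      = ab , _
      isWalk (step ab _ w) = ab , isWalk w
      compat : ∀ {a b y z} (w : ArcWalk a b y z) → Compat G T (a ∷ vertices w)
      compat (arc _)                     = _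
      compat (step _ abc (arc _))        = abc , _
      compat (step _ abc w@(step _ _ _)) = abc , compat w
      last : ∀ {a b y z} (w : ArcWalk a b y z) → lastOf G a (vertices w) ≡ z
      last (arc _)      = refl
      last (step _ _ w) = last w

  infixr 5 _++⟨_⟩_
  _++⟨_⟩_ : ∀ {a b y z w s t} → ArcWalk a b y z → Turn T y z w → ArcWalk z w s t → ArcWalk a b s t
  arc ab         ++⟨ yzw ⟩ w₂ = step ab yzw w₂
  step ab abc w₁ ++⟨ yzw ⟩ w₂ = step ab abc (w₁ ++⟨ yzw ⟩ w₂)

  reverseWalk : ∀ {a b y z} → ArcWalk a b y z → ArcWalk z y b a
  reverseWalk (arc ab) = arc (adj-sym G ab)
  reverseWalk (step {b = b} ab abc w) =
    reverseWalk w ++⟨ turn-sym {T = T} {b = b} abc ⟩ arc (adj-sym G ab)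

module TreeTransitions {n : ℕ} {G : SimpleGraph n} {r : Fin n} (tree : RootedTree G r)
  (c₀ : Fin n) (c₀-child : RootedTree.parent tree c₀ ≡ r) (c₀≢r : c₀ ≢ r) where

  open RootedTree tree

  grand : Fin n → Fin n
  grand v = if does (parent v ≟ r) then c₀ else parent (parent v)

  owner : Fin n → Bool
  owner v = not (does (v ≟ r)) ∧ not (does (v ≟ c₀))

  owns : Fin n → Fin n → Fin n → Bool
  owns v a b = owner v ∧ (does (a ≟ grand v) ∧ does (b ≟ parent v))

  grand-of-child : ∀ {v} → parent v ≡ r → grand v ≡ c₀
  grand-of-child {v} pv≡r rewrite dec-true (parent v ≟ r) pv≡r = refl

  grand-inner : ∀ {v} → parent v ≢ r → grand v ≡ parent (parent v)
  grand-inner {v} pv≢r rewrite dec-false (parent v ≟ r) pv≢r = refl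

  owner-intro : ∀ {v} → v ≢ r → v ≢ c₀ → owner v ≡ true
  owner-intro {v} v≢r v≢c₀ rewrite dec-false (v ≟ r) v≢r | dec-false (v ≟ c₀) v≢c₀ = refl

  owner-elim : ∀ {v} → owner v ≡ true → v ≢ r × v ≢ c₀
  owner-elim {v} ov with v ≟ r | v ≟ c₀
  ... | no v≢r | no v≢c₀ = v≢r , v≢c₀

  owns-intro : ∀ {v} → v ≢ r → v ≢ c₀ → owns v (grand v) (parent v) ≡ true
  owns-intro {v} v≢r v≢c₀
    rewrite owner-intro v≢r v≢c₀ | dec-true (grand v ≟ grand v) refl | dec-true (parent v ≟ parent v) refl
    = refl

  owns-elim : ∀ {v a b} → owns v a b ≡ true → OwnedBy owner grand parent a b v
  owns-elim {v} {a} {b} vab =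
    ∧-conicalˡ _ _ vab , ≟⇒≡ {a = a} (∧-conicalˡ _ _ gp) , ≟⇒≡ {a = b} (∧-conicalʳ _ _ gp)
    where gp = ∧-conicalʳ (owner v) _ vab

  grand-adj : ∀ {v} → v ≢ r → adj G (grand v) (parent v) ≡ true
  grand-adj {v} v≢r with parent v ≟ r
  ... | yes pv≡r = subst (λ p → adj G c₀ p ≡ true) (trans c₀-child (sym pv≡r)) (parent-adj c₀≢r)
  ... | no pv≢r  = adj-sym G (parent-adj pv≢r)

  grand-≢ : ∀ {v} → v ≢ r → v ≢ c₀ → grand v ≢ v
  grand-≢ {v} v≢r v≢c₀ with parent v ≟ r
  ... | yes _    = λ c₀≡v → v≢c₀ (sym c₀≡v)
  ... | no pv≢r  = λ ppv≡v → <-irrefl refl (<-trans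
        (subst (λ u → depth u < depth (parent v)) ppv≡v (depth-parent pv≢r))
        (depth-parent v≢r))

  owned-valid : ∀ {v a b} → OwnedBy owner grand parent a b v →
                adj G a b ≡ true × adj G b v ≡ true × a ≢ v
  owned-valid (ov , refl , refl) with owner-elim ov
  ... | v≢r , v≢c₀ = grand-adj v≢r , adj-sym G (parent-adj v≢r) , grand-≢ v≢r v≢c₀

  transitions : TransitionSet G
  transitions = record
    { mem       = λ a b c → owns c a b ∨ owns a c b
    ; mem-sym   = λ a b c → ∨-comm (owns c a b) (owns a c b)
    ; mem-valid = valid
    }
    where
      valid : ∀ a b c → (owns c a b ∨ owns a c b) ≡ true →
              adj G a b ≡ true × adj G b c ≡ true × a ≢ c
      valid a b c abc with owns c a b in cab
      ... | true = owned-valid (owns-elim cab)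
      ... | false with owned-valid (owns-elim abc)
      ...   | cb , ba , c≢a = adj-sym G ba , adj-sym G cb , λ a≡c → c≢a (sym a≡c)

  owned : ∀ {a b c} → mem transitions a b c ≡ true →
          OwnedBy owner grand parent a b c ⊎ OwnedBy owner grand parent c b a
  owned {a} {b} {c} abc with owns c a b in cab
  ... | true  = inj₁ (owns-elim cab)
  ... | false = inj₂ (owns-elim abc)

  size-≤ : size G transitions ≤ n ∸ 2
  size-≤ = begin
    size G transitions          ≤⟨ size-≤-owners transitions owner grand parent owned ⟩
    ∑[ v < n ] χ (owner v)      ≡⟨ ∑-all-but-two (λ r≡c₀ → c₀≢r (sym r≡c₀)) ⟩
    n ∸ 2                       ∎
    where open ≤-Reasoning

  open ArcWalks transitions

  owned-turn : ∀ {a b c} → owns a c b ≡ true → Turn transitions a b c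
  owned-turn {a} {b} {c} acb = inj₁ (trans (cong (owns c a b ∨_) acb) (∨-zeroʳ (owns c a b)))

  climb-walk : ∀ {v y} → v ≢ r → Climb v y → ArcWalk v (parent v) y (parent y)
  climb-walk v≢r stay              = arc (parent-adj v≢r)
  climb-walk {v} v≢r (up pv≢r pv⇝y) = step (parent-adj v≢r) up-turn (climb-walk pv≢r pv⇝y)
    where
      v≢c₀ : v ≢ c₀
      v≢c₀ v≡c₀ = pv≢r (trans (cong parent v≡c₀) c₀-child)
      up-turn : Turn transitions v (parent v) (parent (parent v))
      up-turn = owned-turn {b = parent v}
        (subst (λ g → owns v g (parent v) ≡ true) (grand-inner pv≢r) (owns-intro v≢r v≢c₀))

  walk-to-root : ∀ {v} → v ≢ r → ∃ λ y → ArcWalk v (parent v) y r × parent y ≡ r × y ≢ r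
  walk-to-root v≢r with climb v≢r
  ... | y , v⇝y , py≡r , y≢r = y , subst (ArcWalk _ _ y) py≡r (climb-walk v≢r v⇝y) , py≡r , y≢r

  cross : ∀ {y} → parent y ≡ r → y ≢ r → Turn transitions y r c₀
  -- not a `with` on y ≟ c₀: it would also rewrite the test inside owner y
  cross {y} py≡r y≢r = [ inj₂ , y-owns ]′ (toSum (y ≟ c₀))
    where
      y-owns : y ≢ c₀ → Turn transitions y r c₀
      y-owns y≢c₀ = owned-turn {b = r} (subst₂ (λ g p → owns y g p ≡ true) (grand-of-child py≡r) py≡r
                                       (owns-intro y≢r y≢c₀))

  bounce : ArcWalk r c₀ c₀ r
  bounce = step r~c₀ (inj₂ refl) (arc (adj-sym G r~c₀))
    where r~c₀ = adj-sym G (subst (λ p → adj G c₀ p ≡ true) c₀-child (parent-adj c₀≢r))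

  into-root : ∀ u → ∃ λ b → ArcWalk u b c₀ r
  into-root u with u ≟ r
  ... | yes refl = c₀ , bounce
  ... | no u≢r with walk-to-root u≢r
  ...   | y , u⇝r , py≡r , y≢r = parent u , (u⇝r ++⟨ cross py≡r y≢r ⟩ bounce)

  connecting : IsConnectingTransitionSet G transitions
  connecting u v with v ≟ r
  ... | yes refl = arcWalk⇒compatible (proj₂ (into-root u))
  ... | no v≢r with walk-to-root v≢r
  ...   | y , v⇝r , py≡r , y≢r = arcWalk⇒compatible
          (proj₂ (into-root u) ++⟨ turn-sym {T = transitions} {b = r} (cross py≡r y≢r) ⟩
           reverseWalk v⇝r)

tree-transitions : ∀ {n} {G : SimpleGraph n} {r} → RootedTree G r → ∀ {v} → v ≢ r →
  ∃ λ T → IsConnectingTransitionSet G T × size G T ≤ n ∸ 2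
tree-transitions tree v≢r with RootedTree.climb tree v≢r
... | c₀ , _ , c₀-child , c₀≢r = transitions , connecting , size-≤
  where open TreeTransitions tree c₀ c₀-child c₀≢r

lemma5 : (n : ℕ) → (G : SimpleGraph n) → 2 ≤ n → Connected G → HasCutVertex G →
    MinConnectingSize G (n ∸ 2)
lemma5 (suc (suc k)) G (s≤s (s≤s _)) connected (x , x-cut) =
  let T , T-connecting , T-size = tree-transitions (bfsTree connected Fin.zero) {Fin.suc Fin.zero} (λ ())
  in (T , T-connecting , ≤-antisym T-size (size-≥ T T-connecting)) , size-≥
  where
    size-≥ : ∀ T → IsConnectingTransitionSet G T → suc (suc k) ∸ 2 ≤ size G T
    size-≥ T T-connecting = LowerBound.size-≥ T x T-connecting x-cut
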